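{- Let $d\geq2$, let $\alpha_1,\dots,\alpha_d\in\mathbb Z$ with $\alpha_d\neq0$, and let $s\in\mathbb Z^{\mathbb N}$ satisfy $s(n+d)+\alpha_1s(n+d-1)+\dots+\alpha_ds(n)=0$ for all $n\geq0$. Let $c$ be a positive integer with $|s(n)|<c^{n+1}$ for all $n\in\mathbb N$, and put $u(n)=s(n)+c^{n+1}$. Let $$B(X)=(X-c)\left(X^d+\alpha_1X^{d-1}+\dots+\alpha_{d-1}X+\alpha_d\right)=X^{d+1}+\gamma_1X^d+\dots+\gamma_{d+1}$$ be the polynomial associated to the recurrence $u(n+d+1)+\gamma_1u(n+d)+\dots+\gamma_{d+1}u(n)=0$ satisfied by $u$ (so $\gamma_{d+1}$ is its free term), let $U_d(X)=u(d)+u(d-1)X+\dots+u(0)X^d$, and let $A(X)$ be the quotient of $B(X)U_d(X)$ upon division by $X^{d+1}$ (i.e. $B(X)U_d(X)=C(X)+X^{d+1}A(X)$ with $\deg C<d+1$). Then there is $n_0$ such that for every sufficiently large $b\in\mathbb N$, for all $n\geq n_0$, $$s(n)=\frac{1}{|\gamma_{d+1}|}\Big(\Big(\big(b^{nd+\lceil n/2\rceil}-b^{n(n+1)}\operatorname{sgn}(\gamma_{d+1})A(b^n)\big)\bmod B(b^n)\Big)\bmod b^n\Big)-c^{n+1}.$$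
   Context: $\mathbb N=\{0,1,2,\dots\}$. For integers $x$ and $y\neq0$, $x\bmod y$ denotes the unique integer $m$ with $0\leq m<|y|$ and $y\mid x-m$ (so it is nonnegative even when $x$ is negative). $\operatorname{sgn}(\gamma_{d+1})\in\{ -1,1\}$ is the sign of $\gamma_{d+1}$. -}

module Defs where

open import Data.Nat as ℕ using (ℕ; zero; suc)
open import Data.Integer using (ℤ; +_; -[1+_]; -_; _+_; _*_; ∣_∣; _<_; _≤?_; _<?_)
open import Data.Integer.DivMod using (_%_)
open import Data.List using (List; []; _∷_; map; foldr; drop; _++_; upTo)
open import Relation.Nullary using (yes; no)

sumℤ : List ℤ → ℤ
sumℤ = foldr _+_ (+ 0)

-- Polynomials over ℤ as coefficient lists, lowest degree first.
Poly : Set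
Poly = List ℤ

polyAdd : Poly → Poly → Poly
polyAdd [] q = q
polyAdd (a ∷ p) [] = a ∷ p
polyAdd (a ∷ p) (b ∷ q) = (a + b) ∷ polyAdd p q

polyMul : Poly → Poly → Poly
polyMul [] q = []
polyMul (a ∷ p) q = polyAdd (map (a *_) q) (+ 0 ∷ polyMul p q)

eval : Poly → ℤ → ℤ
eval [] x = + 0
eval (a ∷ p) x = a + x * eval p x

coeff : Poly → ℕ → ℤ
coeff [] k = + 0
coeff (a ∷ p) zero = a
coeff (a ∷ p) (suc k) = coeff p k

quotXpow : ℕ → Poly → Poly
quotXpow k p = drop k p

-- Sign of an integer in {-1,1} (value at 0 is irrelevant; we take 1).
sgn : ℤ → ℤ
sgn x with x <? + 0
... | yes _ = - (+ 1)
... | no _ = + 1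

-- x mod y : the unique m with 0 ≤ m < |y| and y ∣ x - m (for y ≠ 0).
-- Convention for y = 0 (never used in the statement for large b): x mod 0 = x.
modℤ : ℤ → ℤ → ℤ
modℤ x (+ zero) = x
modℤ x (+ suc n) = + (x % (+ suc n))
modℤ x -[1+ n ] = + (x % -[1+ n ])

-- The characteristic polynomial X^d + α₁X^{d-1} + … + α_d (α indexed 1..d).
charPoly : ℕ → (ℕ → ℤ) → Poly
charPoly d α = map (λ j → α (d ℕ.∸ j)) (upTo d) ++ (+ 1 ∷ [])

polyB : ℕ → (ℕ → ℤ) → ℕ → Poly
polyB d α c = polyMul (- (+ c) ∷ + 1 ∷ []) (charPoly d α)

polyU : ℕ → (ℕ → ℤ) → Poly
polyU d u = map (λ j → u (d ℕ.∸ j)) (upTo (suc d))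

{-# OPTIONS --safe #-}
-- Put x = bⁿ and Wₘ = Σⱼ Bⱼ (u(m+j−1) + u(m+j−2) x + ⋯ + u(m) x^(j−1)), so that W₀ = A(x).  Since B
-- annihilates u, W_{m+1} = x Wₘ − u(m) B(x); hence x^(n+1) A(x) ≡ W_{n+1} (mod B(x)) and
-- W_{n+1} ≡ −γ u(n) (mod x).  The number reduced modulo B(x) is therefore congruent to
-- R = b^(nd+⌈n/2⌉) − sgn(γ) W_{n+1}, and R ≡ |γ| u(n) (mod x).  For b ≥ M c² with a suitable M,
-- |W_{n+1}| ≤ b^(nd+⌈n/2⌉) gives 0 ≤ R < |B(x)|, and 0 ≤ |γ| u(n) < x, so the two reductions return R
-- and then |γ| u(n).
module Submission where

open import Defs
open import Data.Empty using (⊥-elim)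
open import Data.Integer as ℤ using (ℤ; +_; -[1+_]; -_; _+_; _*_; _-_; _^_; ∣_∣; _<_; _≤_; _<?_; +≤+; +<+; -<+)
open import Data.Integer.DivMod using (_/_; a≡a%n+[a/n]*n; n%d<d)
import Data.Integer.Properties as ℤ
open import Algebra.Properties.CommutativeSemigroup ℤ.+-commutativeSemigroup using (x∙yz≈y∙xz)
open import Data.Integer.Tactic.RingSolver using (solve-∀)
import Data.Nat.Tactic.RingSolver as ℕ-Solver
open import Data.List using ([]; _∷_; map; drop; _++_; _∷ʳ_; upTo; applyUpTo; length)
import Data.List.Properties as List
open import Data.Nat as ℕ using (ℕ; zero; suc; z≤n; s≤s; _≥_; ⌈_/2⌉; ⌊_/2⌋)
import Data.Nat.Properties as ℕ
open import Data.Product using (∃; _,_; proj₁; proj₂)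
open import Function using (_∘_)
open import Relation.Binary.PropositionalEquality
open import Relation.Nullary using (yes; no)

applyUpTo-cong : ∀ {A : Set} {f g : ℕ → A} n → (∀ i → i ℕ.< n → f i ≡ g i) →
                 applyUpTo f n ≡ applyUpTo g n
applyUpTo-cong zero    f≡g = refl
applyUpTo-cong (suc n) f≡g = cong₂ _∷_ (f≡g 0 ℕ.z<s) (applyUpTo-cong n (λ i i<n → f≡g (suc i) (ℕ.s<s i<n)))

sumℤ-∷ʳ : ∀ xs y → sumℤ (xs ∷ʳ y) ≡ y + sumℤ xs
sumℤ-∷ʳ []       y = refl
sumℤ-∷ʳ (x ∷ xs) y = trans (cong (_+_ x) (sumℤ-∷ʳ xs y)) (x∙yz≈y∙xz x y (sumℤ xs))

sumℤ-applyUpTo-reverse : ∀ (f : ℕ → ℤ) n →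
                         sumℤ (applyUpTo f n) ≡ sumℤ (applyUpTo (λ i → f (n ℕ.∸ suc i)) n)
sumℤ-applyUpTo-reverse f zero    = refl
sumℤ-applyUpTo-reverse f (suc n) = begin
  sumℤ (applyUpTo f (suc n))   ≡⟨ cong sumℤ (List.applyUpTo-∷ʳ f n) ⟨
  sumℤ (applyUpTo f n ∷ʳ f n)  ≡⟨ sumℤ-∷ʳ (applyUpTo f n) (f n) ⟩
  f n + sumℤ (applyUpTo f n)   ≡⟨ cong (_+_ (f n)) (sumℤ-applyUpTo-reverse f n) ⟩
  f n + sumℤ (applyUpTo (λ i → f (n ℕ.∸ suc i)) n) ∎
  where open ≡-Reasoning

pos-^ : ∀ m n → (+ m) ^ n ≡ + (m ℕ.^ n)
pos-^ m zero    = refl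
pos-^ m (suc n) = trans (cong (+ m *_) (pos-^ m n)) (sym (ℤ.pos-* m (m ℕ.^ n)))

module _ (x : ℤ) where

  open ≡-Reasoning

  eval-polyAdd : ∀ p q → eval (polyAdd p q) x ≡ eval p x + eval q x
  eval-polyAdd []      q       = sym (ℤ.+-identityˡ _)
  eval-polyAdd (a ∷ p) []      = sym (ℤ.+-identityʳ _)
  eval-polyAdd (a ∷ p) (b ∷ q) = begin
    a + b + x * eval (polyAdd p q) x   ≡⟨ cong (λ t → a + b + x * t) (eval-polyAdd p q) ⟩
    a + b + x * (eval p x + eval q x)  ≡⟨ rearrange a b x (eval p x) (eval q x) ⟩
    (a + x * eval p x) + (b + x * eval q x) ∎
    where
    rearrange : ∀ a b x e f → a + b + x * (e + f) ≡ (a + x * e) + (b + x * f)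
    rearrange = solve-∀

  eval-scale : ∀ a p → eval (map (a *_) p) x ≡ a * eval p x
  eval-scale a []      = sym (ℤ.*-zeroʳ a)
  eval-scale a (b ∷ p) = begin
    a * b + x * eval (map (a *_) p) x  ≡⟨ cong (λ t → a * b + x * t) (eval-scale a p) ⟩
    a * b + x * (a * eval p x)         ≡⟨ rearrange a b x (eval p x) ⟩
    a * (b + x * eval p x)             ∎
    where
    rearrange : ∀ a b x e → a * b + x * (a * e) ≡ a * (b + x * e)
    rearrange = solve-∀

  eval-polyMul : ∀ p q → eval (polyMul p q) x ≡ eval p x * eval q x
  eval-polyMul []      q = refl
  eval-polyMul (a ∷ p) q = begin
    eval (polyAdd (map (a *_) q) (+ 0 ∷ polyMul p q)) x  ≡⟨ eval-polyAdd (map (a *_) q) _ ⟩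
    eval (map (a *_) q) x + (+ 0 + x * eval (polyMul p q) x)
      ≡⟨ cong₂ (λ s t → s + (+ 0 + x * t)) (eval-scale a q) (eval-polyMul p q) ⟩
    a * eval q x + (+ 0 + x * (eval p x * eval q x))     ≡⟨ rearrange a x (eval p x) (eval q x) ⟩
    (a + x * eval p x) * eval q x                        ∎
    where
    rearrange : ∀ a x e f → a * f + (+ 0 + x * (e * f)) ≡ (a + x * e) * f
    rearrange = solve-∀

  eval-++ : ∀ p q → eval (p ++ q) x ≡ eval p x + x ^ length p * eval q x
  eval-++ []      q = sym (trans (ℤ.+-identityˡ _) (ℤ.*-identityˡ _))
  eval-++ (a ∷ p) q = begin
    a + x * eval (p ++ q) x                         ≡⟨ cong (λ t → a + x * t) (eval-++ p q) ⟩
    a + x * (eval p x + x ^ length p * eval q x)    ≡⟨ rearrange a x (eval p x) (x ^ length p) (eval q x) ⟩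
    a + x * eval p x + x * x ^ length p * eval q x  ∎
    where
    rearrange : ∀ a x e y f → a + x * (e + y * f) ≡ a + x * e + x * y * f
    rearrange = solve-∀

  eval-drop-polyAdd : ∀ k p q → eval (drop k (polyAdd p q)) x ≡ eval (drop k p) x + eval (drop k q) x
  eval-drop-polyAdd zero    p       q       = eval-polyAdd p q
  eval-drop-polyAdd (suc k) []      q       = sym (ℤ.+-identityˡ _)
  eval-drop-polyAdd (suc k) (a ∷ p) []      = sym (ℤ.+-identityʳ _)
  eval-drop-polyAdd (suc k) (a ∷ p) (b ∷ q) = eval-drop-polyAdd k p q

  eval-drop-scale : ∀ k a p → eval (drop k (map (a *_) p)) x ≡ a * eval (drop k p) x
  eval-drop-scale k a p = trans (cong (λ q → eval q x) (List.drop-map k p)) (eval-scale a (drop k p))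

  eval-coeff-drop : ∀ p → eval p x ≡ coeff p 0 + x * eval (drop 1 p) x
  eval-coeff-drop []      = sym (trans (ℤ.+-identityˡ _) (ℤ.*-zeroʳ x))
  eval-coeff-drop (a ∷ p) = refl

length-polyAdd : ∀ p q → length (polyAdd p q) ≡ length p ℕ.⊔ length q
length-polyAdd []      q       = refl
length-polyAdd (a ∷ p) []      = refl
length-polyAdd (a ∷ p) (b ∷ q) = cong suc (length-polyAdd p q)

length-polyMul≤ : ∀ p q {n} → length q ℕ.≤ suc n → length (polyMul p q) ℕ.≤ length p ℕ.+ n
length-polyMul≤ []      q _     = z≤n
length-polyMul≤ (a ∷ p) q {n} q≤ = begin
  length (polyAdd (map (a *_) q) (+ 0 ∷ polyMul p q))   ≡⟨ length-polyAdd (map (a *_) q) _ ⟩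
  length (map (a *_) q) ℕ.⊔ suc (length (polyMul p q))
    ≤⟨ ℕ.⊔-lub (ℕ.≤-trans (ℕ.≤-reflexive (List.length-map (a *_) q))
                          (ℕ.≤-trans q≤ (s≤s (ℕ.m≤n+m n (length p)))))
               (s≤s (length-polyMul≤ p q q≤)) ⟩
  suc (length p ℕ.+ n)                                  ∎
  where open ℕ.≤-Reasoning

charLow : ℕ → (ℕ → ℤ) → Poly
charLow d α = map (λ j → α (d ℕ.∸ j)) (upTo d)

length-charLow : ∀ d α → length (charLow d α) ≡ d
length-charLow d α = trans (List.length-map _ (upTo d)) (List.length-upTo d)

length-polyB : ∀ d α c → length (polyB d α c) ℕ.≤ suc (suc d)
length-polyB d α c = length-polyMul≤ (- + c ∷ + 1 ∷ []) (charPoly d α) (ℕ.≤-reflexive (begin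
  length (charLow d α ++ + 1 ∷ [])   ≡⟨ List.length-++ (charLow d α) ⟩
  length (charLow d α) ℕ.+ 1         ≡⟨ cong (ℕ._+ 1) (length-charLow d α) ⟩
  d ℕ.+ 1                            ≡⟨ ℕ.+-comm d 1 ⟩
  suc d                              ∎))
  where open ≡-Reasoning

eval-polyB-leading : ∀ x d α c →
  x ^ suc d ≡ eval (polyB d α c) x - ((x - + c) * eval (charLow d α) x - + c * x ^ d)
eval-polyB-leading x d α c = begin
  x * x ^ d
    ≡⟨ rearrange x (+ c) L (x ^ d) ⟩
  ℓ * (L + x ^ d * (+ 1 + x * + 0)) - Q
    ≡⟨ cong (λ k → ℓ * (L + x ^ k * (+ 1 + x * + 0)) - Q) (length-charLow d α) ⟨
  ℓ * (L + x ^ length (charLow d α) * (+ 1 + x * + 0)) - Q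
    ≡⟨ cong (λ e → ℓ * e - Q) (eval-++ x (charLow d α) (+ 1 ∷ [])) ⟨
  ℓ * eval (charPoly d α) x - Q
    ≡⟨ cong (_- Q) (eval-polyMul x (- + c ∷ + 1 ∷ []) (charPoly d α)) ⟨
  eval (polyB d α c) x - Q ∎
  where
  open ≡-Reasoning
  ℓ L Q : ℤ
  ℓ = eval (- + c ∷ + 1 ∷ []) x
  L = eval (charLow d α) x
  Q = (x - + c) * L - + c * x ^ d
  rearrange : ∀ x c L P →
    x * P ≡ (- c + x * (+ 1 + x * + 0)) * (L + P * (+ 1 + x * + 0)) - ((x - c) * L - c * P)
  rearrange = solve-∀

-- Linear recurrences

-- The n-th term of p(E) v, where E is the shift operator (E v)(n) = v(n + 1).
shiftOp : Poly → (ℕ → ℤ) → ℕ → ℤ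
shiftOp []      v n = + 0
shiftOp (a ∷ p) v n = a * v n + shiftOp p v (suc n)

Annihilates : Poly → (ℕ → ℤ) → Set
Annihilates p v = ∀ n → shiftOp p v n ≡ + 0

shiftOp-cong : ∀ p {v w : ℕ → ℤ} n → (∀ k → v k ≡ w k) → shiftOp p v n ≡ shiftOp p w n
shiftOp-cong []      n v≡w = refl
shiftOp-cong (a ∷ p) n v≡w = cong₂ (λ s t → a * s + t) (v≡w n) (shiftOp-cong p (suc n) v≡w)

shiftOp-+ : ∀ p (v w : ℕ → ℤ) n → shiftOp p (λ k → v k + w k) n ≡ shiftOp p v n + shiftOp p w n
shiftOp-+ []      v w n = refl
shiftOp-+ (a ∷ p) v w n = begin
  a * (v n + w n) + shiftOp p (λ k → v k + w k) (suc n)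
    ≡⟨ cong (_+_ (a * (v n + w n))) (shiftOp-+ p v w (suc n)) ⟩
  a * (v n + w n) + (shiftOp p v (suc n) + shiftOp p w (suc n))
    ≡⟨ rearrange a (v n) (w n) (shiftOp p v (suc n)) (shiftOp p w (suc n)) ⟩
  (a * v n + shiftOp p v (suc n)) + (a * w n + shiftOp p w (suc n)) ∎
  where
  open ≡-Reasoning
  rearrange : ∀ a b c e f → a * (b + c) + (e + f) ≡ (a * b + e) + (a * c + f)
  rearrange = solve-∀

shiftOp-* : ∀ p y (v : ℕ → ℤ) n → shiftOp p (λ k → y * v k) n ≡ y * shiftOp p v n
shiftOp-* []      y v n = sym (ℤ.*-zeroʳ y)
shiftOp-* (a ∷ p) y v n = begin
  a * (y * v n) + shiftOp p (λ k → y * v k) (suc n)  ≡⟨ cong (_+_ (a * (y * v n))) (shiftOp-* p y v (suc n)) ⟩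
  a * (y * v n) + y * shiftOp p v (suc n)            ≡⟨ rearrange a y (v n) (shiftOp p v (suc n)) ⟩
  y * (a * v n + shiftOp p v (suc n))                ∎
  where
  open ≡-Reasoning
  rearrange : ∀ a y b e → a * (y * b) + y * e ≡ y * (a * b + e)
  rearrange = solve-∀

shiftOp-^ : ∀ p x n → shiftOp p (x ^_) n ≡ x ^ n * eval p x
shiftOp-^ []      x n = sym (ℤ.*-zeroʳ (x ^ n))
shiftOp-^ (a ∷ p) x n = begin
  a * x ^ n + shiftOp p (x ^_) (suc n)  ≡⟨ cong (_+_ (a * x ^ n)) (shiftOp-^ p x (suc n)) ⟩
  a * x ^ n + x * x ^ n * eval p x      ≡⟨ rearrange a x (x ^ n) (eval p x) ⟩
  x ^ n * (a + x * eval p x)            ∎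
  where
  open ≡-Reasoning
  rearrange : ∀ a x y e → a * y + x * y * e ≡ y * (a + x * e)
  rearrange = solve-∀

shiftOp-offset : ∀ p (v : ℕ → ℤ) m n → shiftOp p (λ k → v (m ℕ.+ k)) n ≡ shiftOp p v (m ℕ.+ n)
shiftOp-offset []      v m n = refl
shiftOp-offset (a ∷ p) v m n =
  cong (_+_ (a * v (m ℕ.+ n))) (trans (shiftOp-offset p v m (suc n)) (cong (shiftOp p v) (ℕ.+-suc m n)))

shiftOp-polyAdd : ∀ p q v n → shiftOp (polyAdd p q) v n ≡ shiftOp p v n + shiftOp q v n
shiftOp-polyAdd []      q       v n = sym (ℤ.+-identityˡ _)
shiftOp-polyAdd (a ∷ p) []      v n = sym (ℤ.+-identityʳ _)
shiftOp-polyAdd (a ∷ p) (b ∷ q) v n = begin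
  (a + b) * v n + shiftOp (polyAdd p q) v (suc n)
    ≡⟨ cong (_+_ ((a + b) * v n)) (shiftOp-polyAdd p q v (suc n)) ⟩
  (a + b) * v n + (shiftOp p v (suc n) + shiftOp q v (suc n))
    ≡⟨ rearrange a b (v n) (shiftOp p v (suc n)) (shiftOp q v (suc n)) ⟩
  (a * v n + shiftOp p v (suc n)) + (b * v n + shiftOp q v (suc n)) ∎
  where
  open ≡-Reasoning
  rearrange : ∀ a b w e f → (a + b) * w + (e + f) ≡ (a * w + e) + (b * w + f)
  rearrange = solve-∀

shiftOp-scale : ∀ a p v n → shiftOp (map (a *_) p) v n ≡ a * shiftOp p v n
shiftOp-scale a []      v n = sym (ℤ.*-zeroʳ a)
shiftOp-scale a (b ∷ p) v n = begin
  a * b * v n + shiftOp (map (a *_) p) v (suc n)  ≡⟨ cong (_+_ (a * b * v n)) (shiftOp-scale a p v (suc n)) ⟩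
  a * b * v n + a * shiftOp p v (suc n)           ≡⟨ rearrange a b (v n) (shiftOp p v (suc n)) ⟩
  a * (b * v n + shiftOp p v (suc n))             ∎
  where
  open ≡-Reasoning
  rearrange : ∀ a b w e → a * b * w + a * e ≡ a * (b * w + e)
  rearrange = solve-∀

shiftOp-linearFactor : ∀ a b p v n →
  shiftOp (polyMul (a ∷ b ∷ []) p) v n ≡ a * shiftOp p v n + b * shiftOp p v (suc n)
shiftOp-linearFactor a b p v n = begin
  shiftOp (polyAdd (map (a *_) p) (+ 0 ∷ polyAdd (map (b *_) p) (+ 0 ∷ []))) v n
    ≡⟨ shiftOp-polyAdd (map (a *_) p) _ v n ⟩
  shiftOp (map (a *_) p) v n + (+ 0 * v n + shiftOp (polyAdd (map (b *_) p) (+ 0 ∷ [])) v (suc n))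
    ≡⟨ cong₂ (λ s t → s + (+ 0 * v n + t)) (shiftOp-scale a p v n) (shiftOp-polyAdd (map (b *_) p) _ v (suc n)) ⟩
  a * S n + (+ 0 * v n + (shiftOp (map (b *_) p) v (suc n) + (+ 0 * v (suc (suc n)) + + 0)))
    ≡⟨ cong (λ t → a * S n + (+ 0 * v n + (t + (+ 0 * v (suc (suc n)) + + 0)))) (shiftOp-scale b p v (suc n)) ⟩
  a * S n + (+ 0 * v n + (b * S (suc n) + (+ 0 * v (suc (suc n)) + + 0)))
    ≡⟨ rearrange a b (S n) (S (suc n)) (v n) (v (suc (suc n))) ⟩
  a * S n + b * S (suc n) ∎
  where
  open ≡-Reasoning
  S : ℕ → ℤ
  S = shiftOp p v
  rearrange : ∀ a b s t y z → a * s + (+ 0 * y + (b * t + (+ 0 * z + + 0))) ≡ a * s + b * t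
  rearrange = solve-∀

shiftOp-++ : ∀ p q v n → shiftOp (p ++ q) v n ≡ shiftOp p v n + shiftOp q v (n ℕ.+ length p)
shiftOp-++ []      q v n = sym (trans (ℤ.+-identityˡ _) (cong (shiftOp q v) (ℕ.+-identityʳ n)))
shiftOp-++ (a ∷ p) q v n = begin
  a * v n + shiftOp (p ++ q) v (suc n)
    ≡⟨ cong (_+_ (a * v n)) (shiftOp-++ p q v (suc n)) ⟩
  a * v n + (shiftOp p v (suc n) + shiftOp q v (suc n ℕ.+ length p))
    ≡⟨ ℤ.+-assoc (a * v n) _ _ ⟨
  a * v n + shiftOp p v (suc n) + shiftOp q v (suc n ℕ.+ length p)
    ≡⟨ cong (λ k → a * v n + shiftOp p v (suc n) + shiftOp q v k) (ℕ.+-suc n (length p)) ⟨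
  a * v n + shiftOp p v (suc n) + shiftOp q v (n ℕ.+ suc (length p)) ∎
  where open ≡-Reasoning

shiftOp-applyUpTo : ∀ f v k n → shiftOp (applyUpTo f k) v n ≡ sumℤ (applyUpTo (λ j → f j * v (n ℕ.+ j)) k)
shiftOp-applyUpTo f v zero    n = refl
shiftOp-applyUpTo f v (suc k) n = cong₂ (λ s t → f 0 * v s + t) (sym (ℕ.+-identityʳ n)) (begin
  shiftOp (applyUpTo (f ∘ suc) k) v (suc n)
    ≡⟨ shiftOp-applyUpTo (f ∘ suc) v k (suc n) ⟩
  sumℤ (applyUpTo (λ j → f (suc j) * v (suc n ℕ.+ j)) k)
    ≡⟨ cong sumℤ (applyUpTo-cong k (λ j _ → cong (λ i → f (suc j) * v i) (ℕ.+-suc n j))) ⟨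
  sumℤ (applyUpTo (λ j → f (suc j) * v (n ℕ.+ suc j)) k) ∎)
  where open ≡-Reasoning

charPoly-annihilates : ∀ d α s →
  (∀ n → s (n ℕ.+ d) + sumℤ (map (λ i → α (suc i) * s (n ℕ.+ d ℕ.∸ suc i)) (upTo d)) ≡ + 0) →
  Annihilates (charPoly d α) s
charPoly-annihilates d α s rec n = begin
  shiftOp (charLow d α ++ + 1 ∷ []) s n
    ≡⟨ shiftOp-++ (charLow d α) (+ 1 ∷ []) s n ⟩
  shiftOp (charLow d α) s n + (+ 1 * s (n ℕ.+ length (charLow d α)) + + 0)
    ≡⟨ cong₂ _+_ lowTerms (cong (λ k → + 1 * s (n ℕ.+ k) + + 0) (length-charLow d α)) ⟩
  sumℤ (map term (upTo d)) + (+ 1 * s (n ℕ.+ d) + + 0)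
    ≡⟨ rearrange (sumℤ (map term (upTo d))) (s (n ℕ.+ d)) ⟩
  s (n ℕ.+ d) + sumℤ (map term (upTo d))
    ≡⟨ rec n ⟩
  + 0 ∎
  where
  open ≡-Reasoning
  term : ℕ → ℤ
  term i = α (suc i) * s (n ℕ.+ d ℕ.∸ suc i)
  rearrange : ∀ t y → t + (+ 1 * y + + 0) ≡ y + t
  rearrange = solve-∀
  reindex : ∀ i → i ℕ.< d → α (d ℕ.∸ (d ℕ.∸ suc i)) * s (n ℕ.+ (d ℕ.∸ suc i)) ≡ term i
  reindex i i<d = cong₂ (λ j k → α j * s k) (ℕ.m∸[m∸n]≡n i<d) (sym (ℕ.+-∸-assoc n i<d))
  lowTerms : shiftOp (charLow d α) s n ≡ sumℤ (map term (upTo d))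
  lowTerms = begin
    shiftOp (charLow d α) s n
      ≡⟨ cong (λ p → shiftOp p s n) (List.map-upTo _ d) ⟩
    shiftOp (applyUpTo (λ j → α (d ℕ.∸ j)) d) s n
      ≡⟨ shiftOp-applyUpTo _ s d n ⟩
    sumℤ (applyUpTo (λ j → α (d ℕ.∸ j) * s (n ℕ.+ j)) d)
      ≡⟨ sumℤ-applyUpTo-reverse _ d ⟩
    sumℤ (applyUpTo (λ i → α (d ℕ.∸ (d ℕ.∸ suc i)) * s (n ℕ.+ (d ℕ.∸ suc i))) d)
      ≡⟨ cong sumℤ (trans (applyUpTo-cong d reindex) (sym (List.map-upTo term d))) ⟩
    sumℤ (map term (upTo d)) ∎

linearFactor-annihilates : ∀ (c : ℤ) p s → Annihilates p s →
  Annihilates (polyMul (- c ∷ + 1 ∷ []) p) (λ n → s n + c ^ suc n)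
linearFactor-annihilates c p s p⊥s n = begin
  shiftOp (polyMul (- c ∷ + 1 ∷ []) p) u n   ≡⟨ shiftOp-linearFactor (- c) (+ 1) p u n ⟩
  - c * shiftOp p u n + + 1 * shiftOp p u (suc n)
    ≡⟨ cong₂ (λ s t → - c * s + + 1 * t) (shiftOp-p-u n) (shiftOp-p-u (suc n)) ⟩
  - c * (c * c ^ n * eval p c) + + 1 * (c * (c * c ^ n) * eval p c)
    ≡⟨ cancel c (c ^ n) (eval p c) ⟩
  + 0 ∎
  where
  open ≡-Reasoning
  u : ℕ → ℤ
  u n = s n + c ^ suc n
  cancel : ∀ c y e → - c * (c * y * e) + + 1 * (c * (c * y) * e) ≡ + 0
  cancel = solve-∀
  shiftOp-p-u : ∀ m → shiftOp p u m ≡ c ^ suc m * eval p c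
  shiftOp-p-u m = begin
    shiftOp p u m                                     ≡⟨ shiftOp-+ p s (λ k → c * c ^ k) m ⟩
    shiftOp p s m + shiftOp p (λ k → c * c ^ k) m     ≡⟨ cong₂ _+_ (p⊥s m) (shiftOp-* p c (c ^_) m) ⟩
    + 0 + c * shiftOp p (c ^_) m                      ≡⟨ ℤ.+-identityˡ _ ⟩
    c * shiftOp p (c ^_) m                            ≡⟨ cong (c *_) (shiftOp-^ p c m) ⟩
    c * (c ^ m * eval p c)                            ≡⟨ ℤ.*-assoc c (c ^ m) (eval p c) ⟨
    c ^ suc m * eval p c                              ∎

-- Windows of a sequence

module Window (u : ℕ → ℤ) where

  open ≡-Reasoning

  window : ℕ → ℕ → Poly
  window m zero    = []
  window m (suc i) = u (m ℕ.+ i) ∷ window m i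

  window-applyUpTo : ∀ m k → window m k ≡ applyUpTo (λ j → u (m ℕ.+ (k ℕ.∸ suc j))) k
  window-applyUpTo m zero    = refl
  window-applyUpTo m (suc k) = cong (u (m ℕ.+ k) ∷_) (window-applyUpTo m k)

  polyU≡window : ∀ d → polyU d u ≡ window 0 (suc d)
  polyU≡window d = trans (List.map-upTo _ (suc d)) (sym (window-applyUpTo 0 (suc d)))

  drop-window : ∀ m k i → drop k (window m (k ℕ.+ i)) ≡ window m i
  drop-window m zero    i = refl
  drop-window m (suc k) i = drop-window m k i

  length-window : ∀ m i → length (window m i) ≡ i
  length-window m zero    = refl
  length-window m (suc i) = cong suc (length-window m i)

  module _ (x : ℤ) where

    windowAt : ℕ → ℕ → ℤ
    windowAt m i = eval (window m i) x

    windowAt-suc : ∀ m i → windowAt (suc m) i ≡ u (m ℕ.+ i) + x * windowAt m i + (- u m) * x ^ i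
    windowAt-suc m zero = begin
      + 0                                     ≡⟨ rearrange (u m) x ⟩
      u m + x * + 0 + (- u m) * + 1           ≡⟨ cong (λ k → u k + x * + 0 + (- u m) * + 1) (ℕ.+-identityʳ m) ⟨
      u (m ℕ.+ 0) + x * + 0 + (- u m) * + 1   ∎
      where
      rearrange : ∀ a x → + 0 ≡ a + x * + 0 + (- a) * + 1
      rearrange = solve-∀
    windowAt-suc m (suc i) = begin
      u (suc m ℕ.+ i) + x * windowAt (suc m) i
        ≡⟨ cong (λ t → u (suc m ℕ.+ i) + x * t) (windowAt-suc m i) ⟩
      u (suc m ℕ.+ i) + x * (u (m ℕ.+ i) + x * windowAt m i + (- u m) * x ^ i)
        ≡⟨ rearrange (u (suc m ℕ.+ i)) (u (m ℕ.+ i)) x (windowAt m i) (u m) (x ^ i) ⟩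
      u (suc m ℕ.+ i) + x * (u (m ℕ.+ i) + x * windowAt m i) + (- u m) * (x * x ^ i)
        ≡⟨ cong (λ k → u k + x * windowAt m (suc i) + (- u m) * x ^ suc i) (ℕ.+-suc m i) ⟨
      u (m ℕ.+ suc i) + x * windowAt m (suc i) + (- u m) * x ^ suc i ∎
      where
      rearrange : ∀ a b x w c y → a + x * (b + x * w + (- c) * y) ≡ a + x * (b + x * w) + (- c) * (x * y)
      rearrange = solve-∀

    shiftOp-windowAt-suc : ∀ p i m →
      shiftOp p (windowAt (suc m)) i ≡ shiftOp p u (m ℕ.+ i) + x * shiftOp p (windowAt m) i + (- u m) * (x ^ i * eval p x)
    shiftOp-windowAt-suc p i m = begin
      shiftOp p (windowAt (suc m)) i
        ≡⟨ shiftOp-cong p i (windowAt-suc m) ⟩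
      shiftOp p (λ k → u (m ℕ.+ k) + x * windowAt m k + (- u m) * x ^ k) i
        ≡⟨ shiftOp-+ p (λ k → u (m ℕ.+ k) + x * windowAt m k) (λ k → (- u m) * x ^ k) i ⟩
      shiftOp p (λ k → u (m ℕ.+ k) + x * windowAt m k) i + shiftOp p (λ k → (- u m) * x ^ k) i
        ≡⟨ cong₂ _+_ (shiftOp-+ p (λ k → u (m ℕ.+ k)) (λ k → x * windowAt m k) i) (shiftOp-* p (- u m) (x ^_) i) ⟩
      shiftOp p (λ k → u (m ℕ.+ k)) i + shiftOp p (λ k → x * windowAt m k) i + (- u m) * shiftOp p (x ^_) i
        ≡⟨ cong₂ _+_ (cong₂ _+_ (shiftOp-offset p u m i) (shiftOp-* p x (windowAt m) i))
                     (cong ((- u m) *_) (shiftOp-^ p x i)) ⟩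
      shiftOp p u (m ℕ.+ i) + x * shiftOp p (windowAt m) i + (- u m) * (x ^ i * eval p x) ∎

    eval-quotXpow-window : ∀ m p k i → length p ℕ.≤ suc k →
      eval (quotXpow k (polyMul p (window m (k ℕ.+ i)))) x ≡ shiftOp p (windowAt m) i
    eval-quotXpow-window m []          k       i _ = cong (λ q → eval q x) (List.drop-[] k)
    eval-quotXpow-window m (a ∷ [])    zero    i _ = begin
      eval (polyAdd (map (a *_) (window m i)) (+ 0 ∷ [])) x
        ≡⟨ eval-polyAdd x (map (a *_) (window m i)) (+ 0 ∷ []) ⟩
      eval (map (a *_) (window m i)) x + (+ 0 + x * + 0)
        ≡⟨ cong₂ _+_ (eval-scale x a (window m i)) (trans (ℤ.+-identityˡ _) (ℤ.*-zeroʳ x)) ⟩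
      a * windowAt m i + + 0 ∎
    eval-quotXpow-window m (a ∷ _ ∷ _) zero    i (s≤s ())
    eval-quotXpow-window m (a ∷ p)     (suc k) i (s≤s len≤) = begin
      eval (drop (suc k) (polyAdd (map (a *_) W) (+ 0 ∷ polyMul p W))) x
        ≡⟨ eval-drop-polyAdd x (suc k) (map (a *_) W) (+ 0 ∷ polyMul p W) ⟩
      eval (drop (suc k) (map (a *_) W)) x + eval (drop k (polyMul p W)) x
        ≡⟨ cong₂ _+_ (eval-drop-scale x (suc k) a W)
                     (cong (λ j → eval (drop k (polyMul p (window m j))) x) (sym (ℕ.+-suc k i))) ⟩
      a * eval (drop (suc k) W) x + eval (drop k (polyMul p (window m (k ℕ.+ suc i)))) x
        ≡⟨ cong₂ _+_ (cong (λ q → a * eval q x) (drop-window m (suc k) i)) (eval-quotXpow-window m p k (suc i) len≤) ⟩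
      a * windowAt m i + shiftOp p (windowAt m) (suc i) ∎
      where
      W : Poly
      W = window m (suc k ℕ.+ i)

    quotAt : Poly → ℕ → ℤ
    quotAt p m = shiftOp p (windowAt m) 0

    module _ (p : Poly) (p⊥u : Annihilates p u) where

      quotAt-suc : ∀ m → quotAt p (suc m) ≡ x * quotAt p m - u m * eval p x
      quotAt-suc m = begin
        quotAt p (suc m)
          ≡⟨ shiftOp-windowAt-suc p 0 m ⟩
        shiftOp p u (m ℕ.+ 0) + x * quotAt p m + (- u m) * (+ 1 * eval p x)
          ≡⟨ cong (λ t → t + x * quotAt p m + (- u m) * (+ 1 * eval p x)) (p⊥u (m ℕ.+ 0)) ⟩
        + 0 + x * quotAt p m + (- u m) * (+ 1 * eval p x)
          ≡⟨ rearrange x (quotAt p m) (u m) (eval p x) ⟩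
        x * quotAt p m - u m * eval p x ∎
        where
        rearrange : ∀ x t a e → + 0 + x * t + (- a) * (+ 1 * e) ≡ x * t - a * e
        rearrange = solve-∀

      quotAt-suc-mod-x : ∀ m → quotAt p (suc m) ≡ x * (quotAt p m - u m * eval (drop 1 p) x) - u m * coeff p 0
      quotAt-suc-mod-x m = begin
        quotAt p (suc m)
          ≡⟨ quotAt-suc m ⟩
        x * quotAt p m - u m * eval p x
          ≡⟨ cong (λ e → x * quotAt p m - u m * e) (eval-coeff-drop x p) ⟩
        x * quotAt p m - u m * (coeff p 0 + x * eval (drop 1 p) x)
          ≡⟨ rearrange x (quotAt p m) (u m) (coeff p 0) (eval (drop 1 p) x) ⟩
        x * (quotAt p m - u m * eval (drop 1 p) x) - u m * coeff p 0 ∎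
        where
        rearrange : ∀ x t a c e → x * t - a * (c + x * e) ≡ x * (t - a * e) - a * c
        rearrange = solve-∀

      x^k*quotAt≡quotAt+multiple : ∀ k → ∃ λ P → x ^ k * quotAt p 0 ≡ quotAt p k + eval p x * P
      x^k*quotAt≡quotAt+multiple zero = + 0 , rearrange (quotAt p 0) (eval p x)
        where
        rearrange : ∀ t e → + 1 * t ≡ t + e * + 0
        rearrange = solve-∀
      x^k*quotAt≡quotAt+multiple (suc k) with x^k*quotAt≡quotAt+multiple k
      ... | P , x^k*q₀≡ = u k + x * P , (begin
        x * x ^ k * quotAt p 0
          ≡⟨ ℤ.*-assoc x (x ^ k) (quotAt p 0) ⟩
        x * (x ^ k * quotAt p 0)
          ≡⟨ cong (x *_) x^k*q₀≡ ⟩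
        x * (quotAt p k + eval p x * P)
          ≡⟨ rearrange x (quotAt p k) (eval p x) P (u k) ⟩
        (x * quotAt p k - u k * eval p x) + eval p x * (u k + x * P)
          ≡⟨ cong (_+ eval p x * (u k + x * P)) (quotAt-suc k) ⟨
        quotAt p (suc k) + eval p x * (u k + x * P) ∎)
        where
        rearrange : ∀ x t e P a → x * (t + e * P) ≡ (x * t - a * e) + e * (a + x * P)
        rearrange = solve-∀

open Window

-- Size estimates

norm : Poly → ℕ
norm []      = 0
norm (a ∷ p) = ∣ a ∣ ℕ.+ norm p

norm-window≤ : ∀ u m i {C} → (∀ j → j ℕ.< i → ∣ u (m ℕ.+ j) ∣ ℕ.≤ C) → norm (window u m i) ℕ.≤ i ℕ.* C
norm-window≤ u m zero    _  = z≤n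
norm-window≤ u m (suc i) u≤ = ℕ.+-mono-≤ (u≤ i (ℕ.n<1+n i)) (norm-window≤ u m i (λ j j<i → u≤ j (ℕ.m<n⇒m<1+n j<i)))

∣shiftOp∣≤ : ∀ p v i {Z} → (∀ j → j ℕ.< i ℕ.+ length p → ∣ v j ∣ ℕ.≤ Z) →
             ∣ shiftOp p v i ∣ ℕ.≤ norm p ℕ.* Z
∣shiftOp∣≤ []      v i     _  = z≤n
∣shiftOp∣≤ (a ∷ p) v i {Z} v≤ = begin
  ∣ a * v i + shiftOp p v (suc i) ∣          ≤⟨ ℤ.∣i+j∣≤∣i∣+∣j∣ (a * v i) _ ⟩
  ∣ a * v i ∣ ℕ.+ ∣ shiftOp p v (suc i) ∣    ≡⟨ cong (ℕ._+ ∣ shiftOp p v (suc i) ∣) (ℤ.abs-* a (v i)) ⟩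
  ∣ a ∣ ℕ.* ∣ v i ∣ ℕ.+ ∣ shiftOp p v (suc i) ∣
    ≤⟨ ℕ.+-mono-≤ (ℕ.*-monoʳ-≤ ∣ a ∣ (v≤ i (ℕ.m<m+n i ℕ.z<s))) (∣shiftOp∣≤ p v (suc i) v≤′) ⟩
  ∣ a ∣ ℕ.* Z ℕ.+ norm p ℕ.* Z               ≡⟨ ℕ.*-distribʳ-+ Z ∣ a ∣ (norm p) ⟨
  (∣ a ∣ ℕ.+ norm p) ℕ.* Z                   ∎
  where
  open ℕ.≤-Reasoning
  v≤′ : ∀ j → j ℕ.< suc i ℕ.+ length p → ∣ v j ∣ ℕ.≤ Z
  v≤′ j j< = v≤ j (ℕ.≤-trans j< (ℕ.≤-reflexive (sym (ℕ.+-suc i (length p)))))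

module _ {X : ℕ} .{{_ : ℕ.NonZero X}} where

  private
    x : ℤ
    x = + X

  ∣eval∣≤norm*X^ : ∀ p k → length p ℕ.≤ suc k → ∣ eval p x ∣ ℕ.≤ norm p ℕ.* X ℕ.^ k
  ∣eval∣≤norm*X^ []              k       _          = z≤n
  ∣eval∣≤norm*X^ (a ∷ [])        k       _          = begin
    ∣ a + x * + 0 ∣                ≡⟨ cong ∣_∣ (trans (cong (_+_ a) (ℤ.*-zeroʳ x)) (ℤ.+-identityʳ a)) ⟩
    ∣ a ∣                          ≤⟨ ℕ.m≤m*n ∣ a ∣ (X ℕ.^ k) {{ℕ.m^n≢0 X k}} ⟩
    ∣ a ∣ ℕ.* X ℕ.^ k              ≡⟨ cong (ℕ._* X ℕ.^ k) (ℕ.+-identityʳ ∣ a ∣) ⟨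
    (∣ a ∣ ℕ.+ 0) ℕ.* X ℕ.^ k      ∎
    where open ℕ.≤-Reasoning
  ∣eval∣≤norm*X^ (a ∷ p@(_ ∷ _)) (suc k) (s≤s len≤) = begin
    ∣ a + x * eval p x ∣                          ≤⟨ ℤ.∣i+j∣≤∣i∣+∣j∣ a (x * eval p x) ⟩
    ∣ a ∣ ℕ.+ ∣ x * eval p x ∣                    ≡⟨ cong (ℕ._+_ ∣ a ∣) (ℤ.abs-* x (eval p x)) ⟩
    ∣ a ∣ ℕ.+ X ℕ.* ∣ eval p x ∣
      ≤⟨ ℕ.+-mono-≤ (ℕ.m≤m*n ∣ a ∣ (X ℕ.^ suc k) {{ℕ.m^n≢0 X (suc k)}})
                    (ℕ.*-monoʳ-≤ X (∣eval∣≤norm*X^ p k len≤)) ⟩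
    ∣ a ∣ ℕ.* X ℕ.^ suc k ℕ.+ X ℕ.* (norm p ℕ.* X ℕ.^ k)
      ≡⟨ rearrange ∣ a ∣ X (norm p) (X ℕ.^ k) ⟩
    (∣ a ∣ ℕ.+ norm p) ℕ.* X ℕ.^ suc k            ∎
    where
    open ℕ.≤-Reasoning
    rearrange : ∀ a X n Y → a ℕ.* (X ℕ.* Y) ℕ.+ X ℕ.* (n ℕ.* Y) ≡ (a ℕ.+ n) ℕ.* (X ℕ.* Y)
    rearrange = ℕ-Solver.solve-∀
  ∣eval∣≤norm*X^ (a ∷ _ ∷ _)     zero    (s≤s ())

  ∣windowAt∣≤ : ∀ u m i d {C} → i ℕ.≤ suc d → (∀ j → j ℕ.< i → ∣ u (m ℕ.+ j) ∣ ℕ.≤ C) →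
                ∣ windowAt u x m i ∣ ℕ.≤ suc d ℕ.* C ℕ.* X ℕ.^ d
  ∣windowAt∣≤ u m i d {C} i≤ u≤ = begin
    ∣ windowAt u x m i ∣
      ≤⟨ ∣eval∣≤norm*X^ (window u m i) d (subst (ℕ._≤ suc d) (sym (length-window u m i)) i≤) ⟩
    norm (window u m i) ℕ.* X ℕ.^ d
      ≤⟨ ℕ.*-monoˡ-≤ (X ℕ.^ d) (ℕ.≤-trans (norm-window≤ u m i u≤) (ℕ.*-monoˡ-≤ C i≤)) ⟩
    suc d ℕ.* C ℕ.* X ℕ.^ d ∎
    where open ℕ.≤-Reasoning

  ∣eval-polyB∣-lower : ∀ d α c →
    X ℕ.^ suc (suc d)
      ℕ.≤ ∣ eval (polyB (suc d) α c) x ∣ ℕ.+ (suc c ℕ.* norm (charLow (suc d) α) ℕ.+ c) ℕ.* X ℕ.^ suc d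
  ∣eval-polyB∣-lower d α c = begin
    X ℕ.^ suc D            ≡⟨ cong ∣_∣ (pos-^ X (suc D)) ⟨
    ∣ x ^ suc D ∣          ≡⟨ cong ∣_∣ (eval-polyB-leading x D α c) ⟩
    ∣ Bx - Q ∣             ≤⟨ ℤ.∣i-j∣≤∣i∣+∣j∣ Bx Q ⟩
    ∣ Bx ∣ ℕ.+ ∣ Q ∣       ≤⟨ ℕ.+-monoʳ-≤ ∣ Bx ∣ ∣Q∣≤ ⟩
    ∣ Bx ∣ ℕ.+ (suc c ℕ.* nL ℕ.+ c) ℕ.* X ℕ.^ D ∎
    where
    open ℕ.≤-Reasoning
    D nL : ℕ
    D  = suc d
    nL = norm (charLow D α)
    L Bx Q : ℤ
    L  = eval (charLow D α) x
    Bx = eval (polyB D α c) x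
    Q  = (x - + c) * L - + c * x ^ D
    ∣Q∣≤ : ∣ Q ∣ ℕ.≤ (suc c ℕ.* nL ℕ.+ c) ℕ.* X ℕ.^ D
    ∣Q∣≤ = begin
      ∣ Q ∣                                              ≤⟨ ℤ.∣i-j∣≤∣i∣+∣j∣ ((x - + c) * L) (+ c * x ^ D) ⟩
      ∣ (x - + c) * L ∣ ℕ.+ ∣ + c * x ^ D ∣
        ≡⟨ cong₂ ℕ._+_ (ℤ.abs-* (x - + c) L)
                       (trans (ℤ.abs-* (+ c) (x ^ D)) (cong (λ y → c ℕ.* ∣ y ∣) (pos-^ X D))) ⟩
      ∣ x - + c ∣ ℕ.* ∣ L ∣ ℕ.+ c ℕ.* X ℕ.^ D
        ≤⟨ ℕ.+-monoˡ-≤ (c ℕ.* X ℕ.^ D)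
             (ℕ.*-mono-≤ (ℤ.∣i-j∣≤∣i∣+∣j∣ x (+ c))
                         (∣eval∣≤norm*X^ (charLow D α) d (ℕ.≤-reflexive (length-charLow D α)))) ⟩
      (X ℕ.+ c) ℕ.* (nL ℕ.* X ℕ.^ d) ℕ.+ c ℕ.* X ℕ.^ D   ≡⟨ rearrange X c nL (X ℕ.^ d) ⟩
      nL ℕ.* X ℕ.^ D ℕ.+ c ℕ.* nL ℕ.* X ℕ.^ d ℕ.+ c ℕ.* X ℕ.^ D
        ≤⟨ ℕ.+-monoˡ-≤ (c ℕ.* X ℕ.^ D)
             (ℕ.+-monoʳ-≤ (nL ℕ.* X ℕ.^ D) (ℕ.*-monoʳ-≤ (c ℕ.* nL) (ℕ.m≤n*m (X ℕ.^ d) X))) ⟩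
      nL ℕ.* X ℕ.^ D ℕ.+ c ℕ.* nL ℕ.* X ℕ.^ D ℕ.+ c ℕ.* X ℕ.^ D ≡⟨ regroup nL c (X ℕ.^ D) ⟩
      (suc c ℕ.* nL ℕ.+ c) ℕ.* X ℕ.^ D                  ∎
      where
      rearrange : ∀ X c n Y → (X ℕ.+ c) ℕ.* (n ℕ.* Y) ℕ.+ c ℕ.* (X ℕ.* Y)
                                ≡ n ℕ.* (X ℕ.* Y) ℕ.+ c ℕ.* n ℕ.* Y ℕ.+ c ℕ.* (X ℕ.* Y)
      rearrange = ℕ-Solver.solve-∀
      regroup : ∀ n c Z → n ℕ.* Z ℕ.+ c ℕ.* n ℕ.* Z ℕ.+ c ℕ.* Z ≡ (suc c ℕ.* n ℕ.+ c) ℕ.* Z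
      regroup = ℕ-Solver.solve-∀

-- Remainders

remainder-unique : ∀ M {r r′ q q′} → r ℕ.< ∣ M ∣ → r′ ℕ.< ∣ M ∣ →
                   + r + q * M ≡ + r′ + q′ * M → r ≡ r′
remainder-unique M {r} {r′} {q} {q′} r< r′< eq =
  ℤ.+-injective (ℤ.i-j≡0⇒i≡j (+ r) (+ r′) (ℤ.∣i∣≡0⇒i≡0 ∣r-r′∣≡0))
  where
  r-r′≡ : + r - + r′ ≡ (q′ - q) * M
  r-r′≡ = begin
    + r - + r′                                       ≡⟨ rearrange (+ r) (+ r′) q q′ M ⟩
    (+ r + q * M) - (+ r′ + q′ * M) + (q′ - q) * M   ≡⟨ cong (λ t → t - (+ r′ + q′ * M) + (q′ - q) * M) eq ⟩
    (+ r′ + q′ * M) - (+ r′ + q′ * M) + (q′ - q) * M ≡⟨ cong (_+ (q′ - q) * M) (ℤ.+-inverseʳ (+ r′ + q′ * M)) ⟩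
    + 0 + (q′ - q) * M                               ≡⟨ ℤ.+-identityˡ _ ⟩
    (q′ - q) * M                                     ∎
    where
    open ≡-Reasoning
    rearrange : ∀ r r′ q q′ M → r - r′ ≡ (r + q * M) - (r′ + q′ * M) + (q′ - q) * M
    rearrange = solve-∀
  ∣r-r′∣<∣M∣ : ∣ + r - + r′ ∣ ℕ.< ∣ M ∣
  ∣r-r′∣<∣M∣ = ℕ.≤-<-trans (ℕ.≤-reflexive (cong ∣_∣ (ℤ.m-n≡m⊖n r r′)))
                           (ℕ.≤-<-trans (ℤ.∣m⊝n∣≤m⊔n r r′) (ℕ.⊔-lub r< r′<))
  ∣r-r′∣≡0 : ∣ + r - + r′ ∣ ≡ 0
  ∣r-r′∣≡0 with ∣ q′ - q ∣ | trans (cong ∣_∣ r-r′≡) (ℤ.abs-* (q′ - q) M)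
  ... | zero  | ∣r-r′∣≡ = ∣r-r′∣≡
  ... | suc k | ∣r-r′∣≡ =
    ⊥-elim (ℕ.<⇒≱ ∣r-r′∣<∣M∣ (ℕ.≤-trans (ℕ.m≤m+n ∣ M ∣ (k ℕ.* ∣ M ∣)) (ℕ.≤-reflexive (sym ∣r-r′∣≡))))

modℤ-unique : ∀ {E M r} q → + 0 ≤ r → ∣ r ∣ ℕ.< ∣ M ∣ → E ≡ r + q * M → modℤ E M ≡ r
modℤ-unique {M = + zero}             q _       ()
modℤ-unique {E} {M@(+ suc _)}  {+ r} q (+≤+ _) r< E≡ =
  cong +_ (remainder-unique M {q = E / M} {q′ = q} (n%d<d E M) r< (trans (sym (a≡a%n+[a/n]*n E M)) E≡))
modℤ-unique {E} {M@(-[1+ _ ])} {+ r} q (+≤+ _) r< E≡ =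
  cong +_ (remainder-unique M {q = E / M} {q′ = q} (n%d<d E M) r< (trans (sym (a≡a%n+[a/n]*n E M)) E≡))

0≤i+n : ∀ i n → ∣ i ∣ ℕ.≤ n → + 0 ≤ i + + n
0≤i+n (+ k)    n _   = +≤+ z≤n
0≤i+n -[1+ k ] n k<n = subst (+ 0 ≤_) (sym (ℤ.⊖-≥ k<n)) (+≤+ z≤n)

sgn*i≡∣i∣ : ∀ i → sgn i * i ≡ + ∣ i ∣
sgn*i≡∣i∣ i with i <? + 0
sgn*i≡∣i∣ (+ k)    | yes (+<+ ())
sgn*i≡∣i∣ -[1+ k ] | yes _    = ℤ.-1*i≡-i -[1+ k ]
sgn*i≡∣i∣ (+ k)    | no _     = ℤ.*-identityˡ (+ k)
sgn*i≡∣i∣ -[1+ k ] | no i≮0   = ⊥-elim (i≮0 -<+)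

∣sgn*i∣≡∣i∣ : ∀ j i → ∣ sgn j * i ∣ ≡ ∣ i ∣
∣sgn*i∣≡∣i∣ j i = trans (ℤ.abs-* (sgn j) i) (trans (cong (ℕ._* ∣ i ∣) ∣sgn∣≡1) (ℕ.*-identityˡ ∣ i ∣))
  where
  ∣sgn∣≡1 : ∣ sgn j ∣ ≡ 1
  ∣sgn∣≡1 with j <? + 0
  ... | yes _ = refl
  ... | no _  = refl

^-distribʳ-* : ∀ m n k → (m ℕ.* n) ℕ.^ k ≡ m ℕ.^ k ℕ.* n ℕ.^ k
^-distribʳ-* m n zero    = refl
^-distribʳ-* m n (suc k) = begin
  m ℕ.* n ℕ.* (m ℕ.* n) ℕ.^ k            ≡⟨ cong (m ℕ.* n ℕ.*_) (^-distribʳ-* m n k) ⟩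
  m ℕ.* n ℕ.* (m ℕ.^ k ℕ.* n ℕ.^ k)      ≡⟨ rearrange m n (m ℕ.^ k) (n ℕ.^ k) ⟩
  m ℕ.* m ℕ.^ k ℕ.* (n ℕ.* n ℕ.^ k)      ∎
  where
  open ≡-Reasoning
  rearrange : ∀ m n a b → m ℕ.* n ℕ.* (a ℕ.* b) ≡ m ℕ.* a ℕ.* (n ℕ.* b)
  rearrange = ℕ-Solver.solve-∀

b^[1+⌈n/2⌉]≤b^n : ∀ b .{{_ : ℕ.NonZero b}} n → 2 ℕ.≤ n → b ℕ.* b ℕ.^ ⌈ n /2⌉ ℕ.≤ b ℕ.^ n
b^[1+⌈n/2⌉]≤b^n b (suc (suc n)) _         = ℕ.^-monoʳ-≤ b (ℕ.⌈n/2⌉<n n)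
b^[1+⌈n/2⌉]≤b^n b (suc zero)      (s≤s ())

module _ {M c b : ℕ} .{{_ : ℕ.NonZero M}} .{{_ : ℕ.NonZero c}} (Mc²≤b : M ℕ.* (c ℕ.* c) ℕ.≤ b) where

  M*c^e≤b^k : ∀ {k e} → 1 ℕ.≤ k → e ℕ.≤ k ℕ.+ k → M ℕ.* c ℕ.^ e ℕ.≤ b ℕ.^ k
  M*c^e≤b^k {k} {e} 1≤k e≤2k = begin
    M ℕ.* c ℕ.^ e
      ≤⟨ ℕ.*-mono-≤ (ℕ.≤-trans (ℕ.≤-reflexive (sym (ℕ.*-identityʳ M))) (ℕ.^-monoʳ-≤ M 1≤k)) (ℕ.^-monoʳ-≤ c e≤2k) ⟩
    M ℕ.^ k ℕ.* c ℕ.^ (k ℕ.+ k)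
      ≡⟨ cong (M ℕ.^ k ℕ.*_) (trans (ℕ.^-distribˡ-+-* c k k) (sym (^-distribʳ-* c c k))) ⟩
    M ℕ.^ k ℕ.* (c ℕ.* c) ℕ.^ k        ≡⟨ ^-distribʳ-* M (c ℕ.* c) k ⟨
    (M ℕ.* (c ℕ.* c)) ℕ.^ k            ≤⟨ ℕ.^-monoˡ-≤ k Mc²≤b ⟩
    b ℕ.^ k                            ∎
    where open ℕ.≤-Reasoning

  M*c^n≤b^⌈n/2⌉ : ∀ n → 2 ℕ.≤ n → M ℕ.* c ℕ.^ n ℕ.≤ b ℕ.^ ⌈ n /2⌉
  M*c^n≤b^⌈n/2⌉ n 2≤n = M*c^e≤b^k (ℕ.⌈n/2⌉-mono 2≤n) (begin
    n                          ≡⟨ ℕ.⌊n/2⌋+⌈n/2⌉≡n n ⟨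
    ⌊ n /2⌋ ℕ.+ ⌈ n /2⌉         ≤⟨ ℕ.+-monoˡ-≤ ⌈ n /2⌉ (ℕ.⌊n/2⌋≤⌈n/2⌉ n) ⟩
    ⌈ n /2⌉ ℕ.+ ⌈ n /2⌉         ∎)
    where open ℕ.≤-Reasoning

  M*c^[1+n]≤b^n : ∀ n → 1 ℕ.≤ n → M ℕ.* c ℕ.^ suc n ℕ.≤ b ℕ.^ n
  M*c^[1+n]≤b^n n 1≤n = M*c^e≤b^k 1≤n (ℕ.≤-trans (ℕ.≤-reflexive (ℕ.+-comm 1 n)) (ℕ.+-monoʳ-≤ n 1≤n))

-- The decoding identity

module Decoding
  (d′ : ℕ) (α : ℕ → ℤ) (s : ℕ → ℤ)
  (rec : ∀ n → s (n ℕ.+ suc d′) + sumℤ (map (λ i → α (suc i) * s (n ℕ.+ suc d′ ℕ.∸ suc i)) (upTo (suc d′)))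
               ≡ + 0)
  (c : ℕ) .{{_ : ℕ.NonZero c}} (s-bound : ∀ n → + ∣ s n ∣ < (+ c) ^ suc n)
  where

  d : ℕ
  d = suc d′

  u : ℕ → ℤ
  u n = s n + (+ c) ^ suc n

  B : Poly
  B = polyB d α c

  γ : ℤ
  γ = coeff B 0

  A : Poly
  A = quotXpow (suc d) (polyMul B (polyU d u))

  B⊥u : Annihilates B u
  B⊥u = linearFactor-annihilates (+ c) (charPoly d α) s (charPoly-annihilates d α s rec)

  ∣s∣<c^ : ∀ k → ∣ s k ∣ ℕ.< c ℕ.^ suc k
  ∣s∣<c^ k = ℤ.drop‿+<+ (subst (+ ∣ s k ∣ <_) (pos-^ c (suc k)) (s-bound k))

  0≤u : ∀ k → + 0 ≤ u k
  0≤u k = subst (λ t → + 0 ≤ s k + t) (sym (pos-^ c (suc k)))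
                (0≤i+n (s k) (c ℕ.^ suc k) (ℕ.<⇒≤ (∣s∣<c^ k)))

  ∣u∣≤ : ∀ k → ∣ u k ∣ ℕ.≤ 2 ℕ.* c ℕ.^ suc k
  ∣u∣≤ k = begin
    ∣ s k + (+ c) ^ suc k ∣             ≤⟨ ℤ.∣i+j∣≤∣i∣+∣j∣ (s k) ((+ c) ^ suc k) ⟩
    ∣ s k ∣ ℕ.+ ∣ (+ c) ^ suc k ∣       ≡⟨ cong (λ t → ∣ s k ∣ ℕ.+ ∣ t ∣) (pos-^ c (suc k)) ⟩
    ∣ s k ∣ ℕ.+ c ℕ.^ suc k             ≤⟨ ℕ.+-monoˡ-≤ (c ℕ.^ suc k) (ℕ.<⇒≤ (∣s∣<c^ k)) ⟩
    c ℕ.^ suc k ℕ.+ c ℕ.^ suc k         ≡⟨ cong (c ℕ.^ suc k ℕ.+_) (ℕ.+-identityʳ (c ℕ.^ suc k)) ⟨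
    2 ℕ.* c ℕ.^ suc k                   ∎
    where open ℕ.≤-Reasoning

  encoding : ℕ → ℕ → ℤ → ℤ
  encoding b n y = (+ b) ^ (n ℕ.* d ℕ.+ ⌈ n /2⌉) - (+ b) ^ (n ℕ.* suc n) * sgn γ * eval A y

  -- M bounds the constants of the three size estimates below, and b ≥ M c² gives b^k ≥ M c^e for e ≤ 2k.
  K K′ D M b₀ : ℕ
  K  = norm B
  K′ = suc c ℕ.* norm (charLow d α) ℕ.+ c
  D  = K ℕ.* (suc d ℕ.* (2 ℕ.* c ℕ.^ suc (suc d)))
  M  = 2 ℕ.* suc ∣ γ ∣ ℕ.+ (K′ ℕ.+ 3) ℕ.+ D
  b₀ = M ℕ.* (c ℕ.* c)

  2[1+∣γ∣]≤M : 2 ℕ.* suc ∣ γ ∣ ℕ.≤ M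
  2[1+∣γ∣]≤M = ℕ.≤-trans (ℕ.m≤m+n (2 ℕ.* suc ∣ γ ∣) (K′ ℕ.+ 3))
                         (ℕ.m≤m+n (2 ℕ.* suc ∣ γ ∣ ℕ.+ (K′ ℕ.+ 3)) D)

  K′+3≤M : K′ ℕ.+ 3 ℕ.≤ M
  K′+3≤M = ℕ.≤-trans (ℕ.m≤n+m (K′ ℕ.+ 3) (2 ℕ.* suc ∣ γ ∣))
                     (ℕ.m≤m+n (2 ℕ.* suc ∣ γ ∣ ℕ.+ (K′ ℕ.+ 3)) D)

  D≤M : D ℕ.≤ M
  D≤M = ℕ.m≤n+m D (2 ℕ.* suc ∣ γ ∣ ℕ.+ (K′ ℕ.+ 3))

  module AtScale (b : ℕ) (b≥b₀ : b ≥ b₀) (n : ℕ) (n≥2 : n ≥ 2) where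

    X H V : ℕ
    X = b ℕ.^ n
    H = b ℕ.^ ⌈ n /2⌉
    V = X ℕ.^ d ℕ.* H

    x : ℤ
    x = + X

    M≤b : M ℕ.≤ b
    M≤b = ℕ.≤-trans (ℕ.m≤m*n M (c ℕ.* c) {{ℕ.m*n≢0 c c}}) b≥b₀

    instance
      b≢0 : ℕ.NonZero b
      b≢0 = ℕ.>-nonZero (ℕ.<-≤-trans ℕ.z<s M≤b)
      X≢0 : ℕ.NonZero X
      X≢0 = ℕ.m^n≢0 b n
      H≢0 : ℕ.NonZero H
      H≢0 = ℕ.m^n≢0 b ⌈ n /2⌉

    W : ℕ → ℤ
    W = quotAt u x B

    R : ℤ
    R = - (sgn γ * W (suc n)) + + V

    E : ℤ
    E = encoding b n x

    b^[nd+⌈n/2⌉]≡V : (+ b) ^ (n ℕ.* d ℕ.+ ⌈ n /2⌉) ≡ + V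
    b^[nd+⌈n/2⌉]≡V = trans (pos-^ b (n ℕ.* d ℕ.+ ⌈ n /2⌉))
      (cong +_ (trans (ℕ.^-distribˡ-+-* b (n ℕ.* d) ⌈ n /2⌉) (cong (ℕ._* H) (sym (ℕ.^-*-assoc b n d)))))

    b^[n*[n+1]]≡x^[n+1] : (+ b) ^ (n ℕ.* suc n) ≡ x ^ suc n
    b^[n*[n+1]]≡x^[n+1] = trans (pos-^ b (n ℕ.* suc n))
      (trans (cong +_ (sym (ℕ.^-*-assoc b n (suc n)))) (sym (pos-^ X (suc n))))

    eval-A : eval A x ≡ W 0
    eval-A = trans (cong (λ U → eval (quotXpow (suc d) (polyMul B U)) x)
                         (trans (polyU≡window u d) (cong (window u 0) (sym (ℕ.+-identityʳ (suc d))))))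
                   (eval-quotXpow-window u x 0 B (suc d) 0 (length-polyB d α c))

    E≡R+multiple : ∃ λ P → E ≡ R + P * eval B x
    E≡R+multiple = - sgn γ * P , (begin
      (+ b) ^ (n ℕ.* d ℕ.+ ⌈ n /2⌉) - (+ b) ^ (n ℕ.* suc n) * sgn γ * eval A x
        ≡⟨ cong₂ (λ v y → v - y * sgn γ * eval A x) b^[nd+⌈n/2⌉]≡V b^[n*[n+1]]≡x^[n+1] ⟩
      + V - x ^ suc n * sgn γ * eval A x         ≡⟨ cong (λ t → + V - x ^ suc n * sgn γ * t) eval-A ⟩
      + V - x ^ suc n * sgn γ * W 0              ≡⟨ rearrange₁ (+ V) (x ^ suc n) (sgn γ) (W 0) ⟩
      + V - sgn γ * (x ^ suc n * W 0)            ≡⟨ cong (λ t → + V - sgn γ * t) x^[n+1]*W₀≡ ⟩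
      + V - sgn γ * (W (suc n) + eval B x * P)   ≡⟨ rearrange₂ (+ V) (sgn γ) (W (suc n)) (eval B x) P ⟩
      R + (- sgn γ * P) * eval B x               ∎)
      where
      open ≡-Reasoning
      rearrange₁ : ∀ v y g t → v - y * g * t ≡ v - g * (y * t)
      rearrange₁ = solve-∀
      rearrange₂ : ∀ v g w e P → v - g * (w + e * P) ≡ (- (g * w) + v) + (- g * P) * e
      rearrange₂ = solve-∀
      P : ℤ
      P = proj₁ (x^k*quotAt≡quotAt+multiple u x B B⊥u (suc n))
      x^[n+1]*W₀≡ : x ^ suc n * W 0 ≡ W (suc n) + eval B x * P
      x^[n+1]*W₀≡ = proj₂ (x^k*quotAt≡quotAt+multiple u x B B⊥u (suc n))

    R≡∣γ∣u+multiple : ∃ λ Q → R ≡ + ∣ γ ∣ * u n + Q * x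
    R≡∣γ∣u+multiple = Z - sgn γ * Y , (begin
      - (sgn γ * W (suc n)) + + V
        ≡⟨ cong₂ (λ t v → - (sgn γ * t) + v) (quotAt-suc-mod-x u x B B⊥u n) V≡x*Z ⟩
      - (sgn γ * (x * Y - u n * γ)) + x * Z       ≡⟨ rearrange (sgn γ) x Y (u n) γ Z ⟩
      (sgn γ * γ) * u n + (Z - sgn γ * Y) * x     ≡⟨ cong (λ t → t * u n + (Z - sgn γ * Y) * x) (sgn*i≡∣i∣ γ) ⟩
      + ∣ γ ∣ * u n + (Z - sgn γ * Y) * x         ∎)
      where
      open ≡-Reasoning
      Y Z : ℤ
      Y = W n - u n * eval (drop 1 B) x
      Z = + (X ℕ.^ d′ ℕ.* H)
      V≡x*Z : + V ≡ x * Z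
      V≡x*Z = trans (cong +_ (ℕ.*-assoc X (X ℕ.^ d′) H)) (ℤ.pos-* X (X ℕ.^ d′ ℕ.* H))
      rearrange : ∀ g x y a γ z → - (g * (x * y - a * γ)) + x * z ≡ (g * γ) * a + (z - g * y) * x
      rearrange = solve-∀

    ∣W∣≤V : ∣ W (suc n) ∣ ℕ.≤ V
    ∣W∣≤V = begin
      ∣ W (suc n) ∣                    ≤⟨ ∣shiftOp∣≤ B (windowAt u x (suc n)) 0 windowAt≤ ⟩
      K ℕ.* (suc d ℕ.* C ℕ.* X ℕ.^ d)  ≡⟨ rearrange K (suc d) (c ℕ.^ n) (c ℕ.^ suc (suc d)) (X ℕ.^ d) ⟩
      D ℕ.* c ℕ.^ n ℕ.* X ℕ.^ d        ≤⟨ ℕ.*-monoˡ-≤ (X ℕ.^ d) (ℕ.*-monoˡ-≤ (c ℕ.^ n) D≤M) ⟩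
      M ℕ.* c ℕ.^ n ℕ.* X ℕ.^ d        ≤⟨ ℕ.*-monoˡ-≤ (X ℕ.^ d) (M*c^n≤b^⌈n/2⌉ {M} {c} b≥b₀ n n≥2) ⟩
      H ℕ.* X ℕ.^ d                    ≡⟨ ℕ.*-comm H (X ℕ.^ d) ⟩
      V                                ∎
      where
      open ℕ.≤-Reasoning
      C : ℕ
      C = 2 ℕ.* (c ℕ.^ n ℕ.* c ℕ.^ suc (suc d))
      rearrange : ∀ K e a b y → K ℕ.* (e ℕ.* (2 ℕ.* (a ℕ.* b)) ℕ.* y) ≡ K ℕ.* (e ℕ.* (2 ℕ.* b)) ℕ.* a ℕ.* y
      rearrange = ℕ-Solver.solve-∀
      ∣u∣≤C : ∀ j → j ℕ.< suc d → ∣ u (suc n ℕ.+ j) ∣ ℕ.≤ C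
      ∣u∣≤C j j<1+d = begin
        ∣ u (suc n ℕ.+ j) ∣               ≤⟨ ∣u∣≤ (suc n ℕ.+ j) ⟩
        2 ℕ.* c ℕ.^ suc (suc n ℕ.+ j)     ≤⟨ ℕ.*-monoʳ-≤ 2 (ℕ.^-monoʳ-≤ c exponent≤) ⟩
        2 ℕ.* c ℕ.^ (n ℕ.+ suc (suc d))   ≡⟨ cong (2 ℕ.*_) (ℕ.^-distribˡ-+-* c n (suc (suc d))) ⟩
        C                                 ∎
        where
        exponent≤ : suc (suc n ℕ.+ j) ℕ.≤ n ℕ.+ suc (suc d)
        exponent≤ = ℕ.≤-trans (s≤s (s≤s (ℕ.+-monoʳ-≤ n (ℕ.≤-pred j<1+d))))
                              (ℕ.≤-reflexive (sym (trans (ℕ.+-suc n (suc d)) (cong suc (ℕ.+-suc n d)))))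
      windowAt≤ : ∀ j → j ℕ.< length B → ∣ windowAt u x (suc n) j ∣ ℕ.≤ suc d ℕ.* C ℕ.* X ℕ.^ d
      windowAt≤ j j<len = ∣windowAt∣≤ u (suc n) j d j≤1+d (λ l l<j → ∣u∣≤C l (ℕ.<-≤-trans l<j j≤1+d))
        where
        j≤1+d : j ℕ.≤ suc d
        j≤1+d = ℕ.≤-pred (ℕ.≤-trans j<len (length-polyB d α c))

    ∣-sgn*W∣≤V : ∣ - (sgn γ * W (suc n)) ∣ ℕ.≤ V
    ∣-sgn*W∣≤V = ℕ.≤-trans (ℕ.≤-reflexive (trans (ℤ.∣-i∣≡∣i∣ (sgn γ * W (suc n))) (∣sgn*i∣≡∣i∣ γ (W (suc n)))))
                          ∣W∣≤V

    ∣R∣<∣B[x]∣ : ∣ R ∣ ℕ.< ∣ eval B x ∣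
    ∣R∣<∣B[x]∣ = ℕ.+-cancelʳ-< (K′ ℕ.* X ℕ.^ d) ∣ R ∣ ∣ eval B x ∣ (begin-strict
      ∣ R ∣ ℕ.+ K′ ℕ.* X ℕ.^ d                    ≤⟨ ℕ.+-monoˡ-≤ (K′ ℕ.* X ℕ.^ d) ∣R∣≤V+V ⟩
      V ℕ.+ V ℕ.+ K′ ℕ.* X ℕ.^ d                  ≡⟨ rearrange (X ℕ.^ d) H K′ ⟩
      (H ℕ.+ H ℕ.+ K′) ℕ.* X ℕ.^ d                <⟨ ℕ.*-monoˡ-< (X ℕ.^ d) {{ℕ.m^n≢0 X d}} H+H+K′<X ⟩
      X ℕ.* X ℕ.^ d                               ≤⟨ ∣eval-polyB∣-lower d′ α c ⟩
      ∣ eval B x ∣ ℕ.+ K′ ℕ.* X ℕ.^ d             ∎)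
      where
      open ℕ.≤-Reasoning
      rearrange : ∀ Y H K → Y ℕ.* H ℕ.+ Y ℕ.* H ℕ.+ K ℕ.* Y ≡ (H ℕ.+ H ℕ.+ K) ℕ.* Y
      rearrange = ℕ-Solver.solve-∀
      ∣R∣≤V+V : ∣ R ∣ ℕ.≤ V ℕ.+ V
      ∣R∣≤V+V = ℕ.≤-trans (ℤ.∣i+j∣≤∣i∣+∣j∣ (- (sgn γ * W (suc n))) (+ V)) (ℕ.+-monoˡ-≤ V ∣-sgn*W∣≤V)
      H+H+K′<X : H ℕ.+ H ℕ.+ K′ ℕ.< X
      H+H+K′<X = begin-strict
        H ℕ.+ H ℕ.+ K′                            ≤⟨ ℕ.+-monoʳ-≤ (H ℕ.+ H) (ℕ.m≤m*n K′ H) ⟩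
        H ℕ.+ H ℕ.+ K′ ℕ.* H                      ≡⟨ regroup H K′ ⟩
        (K′ ℕ.+ 2) ℕ.* H                          <⟨ ℕ.*-monoˡ-< H (ℕ.+-monoʳ-< K′ (ℕ.n<1+n 2)) ⟩
        (K′ ℕ.+ 3) ℕ.* H                          ≤⟨ ℕ.*-monoˡ-≤ H (ℕ.≤-trans K′+3≤M M≤b) ⟩
        b ℕ.* H                                   ≤⟨ b^[1+⌈n/2⌉]≤b^n b n n≥2 ⟩
        X                                         ∎
        where
        regroup : ∀ H K → H ℕ.+ H ℕ.+ K ℕ.* H ≡ (K ℕ.+ 2) ℕ.* H
        regroup = ℕ-Solver.solve-∀

    ∣∣γ∣u∣<X : ∣ + ∣ γ ∣ * u n ∣ ℕ.< X
    ∣∣γ∣u∣<X = begin-strict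
      ∣ + ∣ γ ∣ * u n ∣                  ≡⟨ ℤ.abs-* (+ ∣ γ ∣) (u n) ⟩
      ∣ γ ∣ ℕ.* ∣ u n ∣                  ≤⟨ ℕ.*-monoʳ-≤ ∣ γ ∣ (∣u∣≤ n) ⟩
      ∣ γ ∣ ℕ.* (2 ℕ.* c ℕ.^ suc n)      <⟨ ℕ.*-monoˡ-< (2 ℕ.* c ℕ.^ suc n) {{2c^[n+1]≢0}} (ℕ.n<1+n ∣ γ ∣) ⟩
      suc ∣ γ ∣ ℕ.* (2 ℕ.* c ℕ.^ suc n)  ≡⟨ regroup ∣ γ ∣ (c ℕ.^ suc n) ⟩
      2 ℕ.* suc ∣ γ ∣ ℕ.* c ℕ.^ suc n    ≤⟨ ℕ.*-monoˡ-≤ (c ℕ.^ suc n) 2[1+∣γ∣]≤M ⟩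
      M ℕ.* c ℕ.^ suc n                  ≤⟨ M*c^[1+n]≤b^n {M} {c} b≥b₀ n (ℕ.≤-trans (s≤s z≤n) n≥2) ⟩
      X                                  ∎
      where
      open ℕ.≤-Reasoning
      2c^[n+1]≢0 : ℕ.NonZero (2 ℕ.* c ℕ.^ suc n)
      2c^[n+1]≢0 = ℕ.m*n≢0 2 (c ℕ.^ suc n) {{_}} {{ℕ.m^n≢0 c (suc n)}}
      regroup : ∀ g y → suc g ℕ.* (2 ℕ.* y) ≡ 2 ℕ.* suc g ℕ.* y
      regroup = ℕ-Solver.solve-∀

    0≤R : + 0 ≤ R
    0≤R = 0≤i+n (- (sgn γ * W (suc n))) V ∣-sgn*W∣≤V

    0≤∣γ∣u : + 0 ≤ + ∣ γ ∣ * u n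
    0≤∣γ∣u = subst (λ t → + 0 ≤ + ∣ γ ∣ * t) (ℤ.0≤i⇒+∣i∣≡i (0≤u n))
                   (subst (+ 0 ≤_) (ℤ.pos-* ∣ γ ∣ ∣ u n ∣) (+≤+ z≤n))

    decode : + ∣ γ ∣ * u n ≡ modℤ (modℤ E (eval B x)) x
    decode = begin
      + ∣ γ ∣ * u n
        ≡⟨ modℤ-unique (proj₁ R≡∣γ∣u+multiple) 0≤∣γ∣u ∣∣γ∣u∣<X (proj₂ R≡∣γ∣u+multiple) ⟨
      modℤ R x
        ≡⟨ cong (λ t → modℤ t x) (modℤ-unique (proj₁ E≡R+multiple) 0≤R ∣R∣<∣B[x]∣ (proj₂ E≡R+multiple)) ⟨
      modℤ (modℤ E (eval B x)) x ∎
      where open ≡-Reasoning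

  decode-at : ∀ b → b ≥ b₀ → ∀ n → n ≥ 2 →
              + ∣ γ ∣ * u n ≡ modℤ (modℤ (encoding b n ((+ b) ^ n)) (eval B ((+ b) ^ n))) ((+ b) ^ n)
  decode-at b b≥b₀ n n≥2 = subst (λ y → + ∣ γ ∣ * u n ≡ modℤ (modℤ (encoding b n y) (eval B y)) y)
                                 (sym (pos-^ b n)) (AtScale.decode b b≥b₀ n n≥2)

corollary2 : (d : ℕ) → d ≥ 2 → (α : ℕ → ℤ) → α d ≢ + 0 →
  (s : ℕ → ℤ) →
  (∀ n → s (n ℕ.+ d) + sumℤ (map (λ i → α (ℕ.suc i) * s (n ℕ.+ d ℕ.∸ ℕ.suc i)) (upTo d)) ≡ + 0) →
  (c : ℕ) → c ≥ 1 → (∀ n → + ∣ s n ∣ < (+ c) ^ ℕ.suc n) →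
  let u = λ n → s n + (+ c) ^ ℕ.suc n
      B = polyB d α c
      γ = coeff B 0
      A = quotXpow (ℕ.suc d) (polyMul B (polyU d u))
  in ∃ λ n₀ → ∃ λ b₀ → ∀ (b : ℕ) → b ≥ b₀ → ∀ (n : ℕ) → n ≥ n₀ →
     (+ ∣ γ ∣) * (s n + (+ c) ^ ℕ.suc n)
       ≡ modℤ (modℤ ((+ b) ^ (n ℕ.* d ℕ.+ ⌈ n /2⌉)
                       - (+ b) ^ (n ℕ.* ℕ.suc n) * sgn γ * eval A ((+ b) ^ n))
                    (eval B ((+ b) ^ n)))
              ((+ b) ^ n)
corollary2 (suc (suc d₀)) _ α _ s rec c c≥1 s-bound = 2 , b₀ , decode-at
  where open Decoding (suc d₀) α s rec c {{ℕ.>-nonZero c≥1}} s-bound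
corollary2 (suc zero) (s≤s ()) _ _ _ _ _ _ _
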